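{- Let $k\ge3$ and let $\mathrm C_k$ be the cycle graph on the vertices $1,\dots,k$. Then $\det(\mathsf C^+_{\mathrm C_k})=\pm2X_1\cdots X_k$ if $k$ is odd, and $\det(\mathsf C^+_{\mathrm C_k})=0$ if $k$ is even.
   Context: For a graph $\Gamma$ with vertices ordered $v_1,\dots,v_n$ and edge set $E$, $\mathsf C^+_\Gamma\in\mathrm{Mat}_{|E|\times n}(\mathbf Z[X_{v_1},\dots,X_{v_n}])$ has rows indexed by edges (in some order): for $e=\{v_i,v_j\}$ with $i\le j$, the entry in row $e$, column $k$ is $X_{v_i}$ if $k=j$, $X_{v_j}$ if $k=i\neq j$, and $0$ otherwise. Here $X_i$ stands for $X_{v_i}$ with $v_i=i$. (The determinant is well defined up to sign, independent of the orderings chosen.) -}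

module Defs where

open import Level using (Level)
open import Algebra.Bundles using (CommutativeRing)
open import Data.Nat using (ℕ; zero; suc; _<?_)
open import Data.Nat.Properties using ()
open import Data.Fin using (Fin; zero; suc; toℕ; fromℕ<; punchIn)
open import Data.Fin.Properties using (_≟_)
open import Data.Product using (_×_; _,_)
open import Data.Bool using (Bool; true; false)
open import Relation.Nullary using (yes; no)
open import Data.Nat using (s≤s)

module _ {c ℓ : Level} (R : CommutativeRing c ℓ) where
  open CommutativeRing R using (Carrier; _+_; _*_; -_; 0#; 1#)

  Σ[_] : {n : ℕ} → (Fin n → Carrier) → Carrier
  Σ[_] {zero}  f = 0#
  Σ[_] {suc n} f = f zero + Σ[_] (λ i → f (suc i))

  Π[_] : {n : ℕ} → (Fin n → Carrier) → Carrier
  Π[_] {zero}  f = 1#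
  Π[_] {suc n} f = f zero * Π[_] (λ i → f (suc i))

  signed : {n : ℕ} → Fin n → Carrier → Carrier
  signed zero    a = a
  signed (suc j) a = - signed j a

  det : {n : ℕ} → (Fin n → Fin n → Carrier) → Carrier
  det {zero}  M = 1#
  det {suc n} M =
    Σ[_] (λ j → signed j (M zero j * det (λ i l → M (suc i) (punchIn j l))))

  -- The matrix C⁺_Γ (with the variables X_v evaluated at x : Fin n → R) for a
  -- graph on vertices Fin n with edges listed as e : Fin m → Fin n × Fin n,
  -- each edge {v_i , v_j} given as (i , j) with i ≤ j.
  Cplus : {m n : ℕ} → (Fin m → Fin n × Fin n) → (Fin n → Carrier) →
          Fin m → Fin n → Carrier
  Cplus edges x e k with edges e
  ... | (i , j) with k ≟ j
  ...   | yes _ = x i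
  ...   | no _ with k ≟ i
  ...     | yes _ = x j
  ...     | no _  = 0#

-- Edges of the cycle graph C_k on vertices Fin k (vertex t ↔ t+1 in the paper):
-- edge number t (t < k-1) is {t, t+1}; edge number k-1 is {0, k-1}.
-- Each is listed as (i , j) with i ≤ j.
cycleEdges : {k : ℕ} → Fin k → Fin k × Fin k
cycleEdges {suc m} t with suc (toℕ t) <? suc m
... | yes p = (t , fromℕ< p)
... | no _  = (zero , t)

{-# OPTIONS --safe #-}
-- Row e of C⁺ of the cycle has X_{e+1} on the diagonal and X_e in column e+1 (indices mod k), so the
-- matrix is upper bidiagonal apart from the entry X_k in the bottom-left corner. Expanding along the
-- first row, such an n × n matrix has determinant Π(diagonal) − (−1)ⁿ c Π(superdiagonal): one minor
-- is upper bidiagonal, the other has the same shape with a zero in its top-left entry. For the cycle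
-- both products are X₁⋯X_k, so the determinant is (1 − (−1)ᵏ) X₁⋯X_k.
module Submission where

open import Defs
open import Level using (Level)
open import Algebra.Bundles using (CommutativeRing)
open import Data.Bool using (Bool; true; if_then_else_)
open import Data.Bool.Properties using (if-eta)
open import Data.Fin using (Fin; zero; suc; toℕ; fromℕ; inject₁; punchIn)
open import Data.Fin.Properties
  using (_≟_; toℕ-injective; toℕ-fromℕ; toℕ-fromℕ<; toℕ-inject₁; inject₁ℕ<; fromℕ≢inject₁)
open import Data.Fin.Relation.Unary.Top using (view; ‵fromℕ; ‵inj₁; view-fromℕ; view-inject₁)
import Data.Nat as ℕ
open import Data.Nat using (ℕ; zero; suc; _≤_; _<_; _<?_; s≤s; s<s; s<s⁻¹)
open import Data.Nat.Properties using (n≮n)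
open import Data.Nat.Divisibility using (_∣_; ∣1⇒≡1; _∣0; ∣-refl; ∣m∣n⇒∣m+n; ∣m+n∣m⇒∣n)
open import Data.Nat.GeneralisedArithmetic using (fold)
open import Data.Product using (∃; _×_; _,_)
open import Data.Vec.Functional using (_∷_; tail)
open import Function using (_∘_)
open import Relation.Nullary using (¬_; yes; no; does; contradiction)
open import Relation.Nullary.Decidable using (dec-true; dec-false)
open import Relation.Binary.PropositionalEquality as ≡ using (_≡_; refl; cong; subst)

next : ∀ {n} → Fin (suc n) → Fin (suc n)
next i with view i
... | ‵fromℕ            = zero
... | ‵inj₁ {i = j} _   = suc j

next-inject₁ : ∀ {n} (i : Fin n) → next (inject₁ i) ≡ suc i
next-inject₁ i rewrite view-inject₁ i = refl

next-fromℕ : ∀ n → next (fromℕ n) ≡ zero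
next-fromℕ n rewrite view-fromℕ n = refl

cycleEdges-inject₁ : ∀ {n} (i : Fin n) → cycleEdges (inject₁ i) ≡ (inject₁ i , suc i)
cycleEdges-inject₁ {n} i with suc (toℕ (inject₁ i)) <? suc n
... | yes p = cong (inject₁ i ,_) (toℕ-injective (≡.trans (toℕ-fromℕ< p) (cong suc (toℕ-inject₁ i))))
... | no ¬p = contradiction (s<s (inject₁ℕ< i)) ¬p

cycleEdges-fromℕ : ∀ n → cycleEdges (fromℕ n) ≡ (zero , fromℕ n)
cycleEdges-fromℕ n with suc (toℕ (fromℕ n)) <? suc n
... | yes p = contradiction (subst (_< n) (toℕ-fromℕ n) (s<s⁻¹ p)) (n≮n n)
... | no _  = refl

module _ {c ℓ : Level} (R : CommutativeRing c ℓ) where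
  open CommutativeRing R hiding (zero) renaming (refl to ≈-refl)
  open import Algebra.Properties.Ring ring using (-‿distribʳ-*; -0#≈0#; -‿involutive)
  open import Algebra.Properties.CommutativeSemigroup *-commutativeSemigroup using (x∙yz≈y∙xz)
  open import Relation.Binary.Reasoning.Setoid setoid

  Σ-cong : ∀ {n} {f g : Fin n → Carrier} → (∀ i → f i ≈ g i) → Σ[ R ] f ≈ Σ[ R ] g
  Σ-cong {zero}  f≈g = ≈-refl
  Σ-cong {suc n} f≈g = +-cong (f≈g zero) (Σ-cong (f≈g ∘ suc))

  Σ-zero : ∀ {n} {f : Fin n → Carrier} → (∀ i → f i ≈ 0#) → Σ[ R ] f ≈ 0#
  Σ-zero {zero}  f≈0 = ≈-refl
  Σ-zero {suc n} f≈0 = trans (+-cong (f≈0 zero) (Σ-zero (f≈0 ∘ suc))) (+-identityʳ 0#)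

  Π-cong : ∀ {n} {f g : Fin n → Carrier} → (∀ i → f i ≈ g i) → Π[ R ] f ≈ Π[ R ] g
  Π-cong {zero}  f≈g = ≈-refl
  Π-cong {suc n} f≈g = *-cong (f≈g zero) (Π-cong (f≈g ∘ suc))

  Π-init-last : ∀ {n} (f : Fin (suc n) → Carrier) → Π[ R ] f ≈ Π[ R ] (f ∘ inject₁) * f (fromℕ n)
  Π-init-last {zero}  f = *-comm (f zero) 1#
  Π-init-last {suc n} f = begin
    f zero * Π[ R ] (tail f)                                     ≈⟨ *-congˡ (Π-init-last (tail f)) ⟩
    f zero * (Π[ R ] (tail f ∘ inject₁) * f (fromℕ (suc n)))     ≈⟨ *-assoc _ _ _ ⟨
    f zero * Π[ R ] (tail f ∘ inject₁) * f (fromℕ (suc n))       ∎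

  signed-cong : ∀ {n} (j : Fin n) {y z} → y ≈ z → signed R j y ≈ signed R j z
  signed-cong zero    y≈z = y≈z
  signed-cong (suc j) y≈z = -‿cong (signed-cong j y≈z)

  signed-zero : ∀ {n} (j : Fin n) {y} → y ≈ 0# → signed R j y ≈ 0#
  signed-zero zero    y≈0 = y≈0
  signed-zero (suc j) y≈0 = trans (-‿cong (signed-zero j y≈0)) -0#≈0#

  minor : ∀ {n} → Fin (suc n) → (Fin (suc n) → Fin (suc n) → Carrier) → Fin n → Fin n → Carrier
  minor j M i l = M (suc i) (punchIn j l)

  det-cong : ∀ {n} {M N : Fin n → Fin n → Carrier} → (∀ i j → M i j ≈ N i j) → det R M ≈ det R N
  det-cong {zero}  M≈N = ≈-refl
  det-cong {suc n} M≈N =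
    Σ-cong λ j → signed-cong j (*-cong (M≈N zero j) (det-cong λ i l → M≈N (suc i) (punchIn j l)))

  det-firstRow₂ : ∀ {n} (M : Fin (suc (suc n)) → Fin (suc (suc n)) → Carrier) →
                  (∀ j → M zero (suc (suc j)) ≈ 0#) →
                  det R M ≈ M zero zero * det R (minor zero M) - M zero (suc zero) * det R (minor (suc zero) M)
  det-firstRow₂ M row≈0 = +-congˡ (trans (+-congˡ (Σ-zero λ j →
    signed-zero (suc (suc j)) (trans (*-congʳ (row≈0 j)) (zeroˡ _)))) (+-identityʳ _))

  det₁ : (M : Fin 1 → Fin 1 → Carrier) → det R M ≈ M zero zero
  det₁ M = trans (+-identityʳ _) (*-identityʳ _)

  fold-neg-cong : ∀ n {y z} → y ≈ z → fold y -_ n ≈ fold z -_ n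
  fold-neg-cong zero    y≈z = y≈z
  fold-neg-cong (suc n) y≈z = -‿cong (fold-neg-cong n y≈z)

  *-fold-neg : ∀ n u y → u * fold y -_ n ≈ fold (u * y) -_ n
  *-fold-neg zero    u y = ≈-refl
  *-fold-neg (suc n) u y = trans (sym (-‿distribʳ-* u _)) (-‿cong (*-fold-neg n u y))

  fold-neg-even : ∀ n {y} → 2 ∣ n → fold y -_ n ≈ y
  fold-neg-even zero          _   = ≈-refl
  fold-neg-even (suc zero)    2∣1 = contradiction (∣1⇒≡1 2∣1) λ ()
  fold-neg-even (suc (suc n)) 2∣n+2 = trans (-‿involutive _) (fold-neg-even n (∣m+n∣m⇒∣n 2∣n+2 ∣-refl))

  fold-neg-odd : ∀ n {y} → ¬ 2 ∣ n → fold y -_ n ≈ - y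
  fold-neg-odd zero          2∤0 = contradiction (2 ∣0) 2∤0
  fold-neg-odd (suc zero)    _   = ≈-refl
  fold-neg-odd (suc (suc n)) 2∤n+2 = trans (-‿involutive _) (fold-neg-odd n (2∤n+2 ∘ ∣m∣n⇒∣m+n ∣-refl))

  -- Diagonal a, superdiagonal b, bottom-left entry c (ignored in size 1), zero elsewhere.
  cornerBidiagonal : ∀ {n} → (Fin (suc n) → Carrier) → (Fin n → Carrier) → Carrier →
                     Fin (suc n) → Fin (suc n) → Carrier
  cornerBidiagonal a b c zero zero                  = a zero
  cornerBidiagonal a b c zero (suc zero)            = b zero
  cornerBidiagonal a b c zero (suc (suc _))         = 0#
  cornerBidiagonal {suc n} a b c (suc i) zero       = if does (i ≟ fromℕ n) then c else 0#
  cornerBidiagonal {suc n} a b c (suc i) (suc j)    = cornerBidiagonal (tail a) (tail b) 0# i j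

  minor₁-cornerBidiagonal : ∀ {m} (a : Fin (3 ℕ.+ m) → Carrier) (b : Fin (2 ℕ.+ m) → Carrier) c i l →
    minor (suc zero) (cornerBidiagonal a b c) i l ≡ cornerBidiagonal (0# ∷ tail (tail a)) (tail b) c i l
  minor₁-cornerBidiagonal a b c zero    zero          = refl
  minor₁-cornerBidiagonal a b c zero    (suc zero)    = refl
  minor₁-cornerBidiagonal a b c zero    (suc (suc l)) = refl
  minor₁-cornerBidiagonal a b c (suc i) zero          = refl
  minor₁-cornerBidiagonal a b c (suc i) (suc l)       = refl

  det-cornerBidiagonal : ∀ {m} (a : Fin (2 ℕ.+ m) → Carrier) (b : Fin (1 ℕ.+ m) → Carrier) c →
    det R (cornerBidiagonal a b c) ≈ Π[ R ] a - fold (c * Π[ R ] b) -_ (2 ℕ.+ m)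
  det-cornerBidiagonal {zero} a b c = begin
    det R M
      ≈⟨ det-firstRow₂ M (λ ()) ⟩
    a zero * det R (minor zero M) - b zero * det R (minor (suc zero) M)
      ≈⟨ +-cong (*-congˡ (det₁ (minor zero M))) (-‿cong (*-congˡ (det₁ (minor (suc zero) M)))) ⟩
    a zero * a (suc zero) - b zero * c
      ≈⟨ +-cong (*-congˡ (sym (*-identityʳ _))) (-‿cong bc≈--cb) ⟩
    Π[ R ] a - fold (c * Π[ R ] b) -_ 2
      ∎
    where
    M : Fin 2 → Fin 2 → Carrier
    M = cornerBidiagonal a b c
    bc≈--cb : b zero * c ≈ - - (c * (b zero * 1#))
    bc≈--cb = trans (trans (*-comm _ _) (*-congˡ (sym (*-identityʳ _)))) (sym (-‿involutive _))
  det-cornerBidiagonal {suc m} a b c = begin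
    det R M
      ≈⟨ det-firstRow₂ M (λ _ → ≈-refl) ⟩
    a zero * det R (minor zero M) - b zero * det R (minor (suc zero) M)
      ≈⟨ +-cong (*-congˡ det-minor₀) (-‿cong (*-congˡ det-minor₁)) ⟩
    a zero * Π[ R ] (tail a) - b zero * - F
      ≈⟨ +-congˡ (-‿cong (trans (sym (-‿distribʳ-* _ _)) (-‿cong (trans (*-fold-neg (2 ℕ.+ m) _ _)
           (fold-neg-cong (2 ℕ.+ m) (x∙yz≈y∙xz _ _ _)))))) ⟩
    Π[ R ] a - fold (c * Π[ R ] b) -_ (3 ℕ.+ m)
      ∎
    where
    M : Fin (3 ℕ.+ m) → Fin (3 ℕ.+ m) → Carrier
    M = cornerBidiagonal a b c
    F : Carrier
    F = fold (c * Π[ R ] (tail b)) -_ (2 ℕ.+ m)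
    det-minor₀ : det R (minor zero M) ≈ Π[ R ] (tail a)
    det-minor₀ = begin
      det R (cornerBidiagonal (tail a) (tail b) 0#)
        ≈⟨ det-cornerBidiagonal (tail a) (tail b) 0# ⟩
      Π[ R ] (tail a) - fold (0# * Π[ R ] (tail b)) -_ (2 ℕ.+ m)
        ≈⟨ +-congˡ (-‿cong (trans (sym (*-fold-neg (2 ℕ.+ m) _ _)) (zeroˡ _))) ⟩
      Π[ R ] (tail a) - 0#
        ≈⟨ trans (+-congˡ -0#≈0#) (+-identityʳ _) ⟩
      Π[ R ] (tail a)
        ∎
    det-minor₁ : det R (minor (suc zero) M) ≈ - F
    det-minor₁ = begin
      det R (minor (suc zero) M)
        ≈⟨ det-cong (λ i l → reflexive (minor₁-cornerBidiagonal a b c i l)) ⟩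
      det R (cornerBidiagonal (0# ∷ tail (tail a)) (tail b) c)
        ≈⟨ det-cornerBidiagonal (0# ∷ tail (tail a)) (tail b) c ⟩
      0# * Π[ R ] (tail (tail a)) - F
        ≈⟨ trans (+-congʳ (zeroˡ _)) (+-identityˡ _) ⟩
      - F
        ∎

  cornerBidiagonal-inject₁ : ∀ {n} (a : Fin (suc n) → Carrier) b c (i : Fin n) k →
    cornerBidiagonal a b c (inject₁ i) k
      ≡ (if does (k ≟ suc i) then b i else if does (k ≟ inject₁ i) then a (inject₁ i) else 0#)
  cornerBidiagonal-inject₁ a b c zero zero          = refl
  cornerBidiagonal-inject₁ a b c zero (suc zero)    = refl
  cornerBidiagonal-inject₁ a b c zero (suc (suc k)) = refl
  cornerBidiagonal-inject₁ {suc n} a b c (suc i) zero =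
    cong (if_then c else 0#) (dec-false (inject₁ i ≟ fromℕ n) (fromℕ≢inject₁ ∘ ≡.sym))
  cornerBidiagonal-inject₁ a b c (suc i) (suc k) = cornerBidiagonal-inject₁ (tail a) (tail b) 0# i k

  cornerBidiagonal-fromℕ : ∀ {n} (a : Fin (suc n) → Carrier) b c k →
    cornerBidiagonal a b c (fromℕ n) k
      ≡ (if does (k ≟ fromℕ n) then a (fromℕ n) else if does (k ≟ zero) then c else 0#)
  cornerBidiagonal-fromℕ {zero}  a b c zero    = refl
  cornerBidiagonal-fromℕ {suc n} a b c zero    = cong (if_then c else 0#) (dec-true (fromℕ n ≟ fromℕ n) refl)
  cornerBidiagonal-fromℕ {suc n} a b c (suc k) =
    ≡.trans (cornerBidiagonal-fromℕ (tail a) (tail b) 0# k)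
            (cong (if does (k ≟ fromℕ n) then a (fromℕ (suc n)) else_) (if-eta (does (k ≟ zero))))

  Cplus-row : ∀ {m n} (edges : Fin m → Fin n × Fin n) x e {i j} → edges e ≡ (i , j) → ∀ k →
    Cplus R edges x e k ≡ (if does (k ≟ j) then x i else if does (k ≟ i) then x j else 0#)
  Cplus-row edges x e {i} {j} eq k with edges e | eq
  ... | _ | refl with k ≟ j
  ...   | yes _ = refl
  ...   | no _ with k ≟ i
  ...     | yes _ = refl
  ...     | no _  = refl

  Cplus-cycle : ∀ {n} (x : Fin (suc (suc n)) → Carrier) e k →
    Cplus R cycleEdges x e k ≡ cornerBidiagonal (x ∘ next) (x ∘ inject₁) (x (fromℕ (suc n))) e k
  Cplus-cycle {n} x e k with view e
  ... | ‵fromℕ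
    rewrite Cplus-row cycleEdges x _ (cycleEdges-fromℕ (suc n)) k
          | cornerBidiagonal-fromℕ (x ∘ next) (x ∘ inject₁) (x (fromℕ (suc n))) k
          | next-fromℕ (suc n) = refl
  ... | ‵inj₁ {i = i} _
    rewrite Cplus-row cycleEdges x _ (cycleEdges-inject₁ i) k
          | cornerBidiagonal-inject₁ (x ∘ next) (x ∘ inject₁) (x (fromℕ (suc n))) i k
          | next-inject₁ i = refl

  Π-next : ∀ {n} (x : Fin (suc n) → Carrier) → Π[ R ] (x ∘ next) ≈ Π[ R ] x
  Π-next {n} x = begin
    Π[ R ] (x ∘ next)                            ≈⟨ Π-init-last (x ∘ next) ⟩
    Π[ R ] (x ∘ next ∘ inject₁) * x (next (fromℕ n))
      ≈⟨ *-cong (Π-cong λ i → reflexive (cong x (next-inject₁ i))) (reflexive (cong x (next-fromℕ n))) ⟩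
    Π[ R ] (tail x) * x zero                     ≈⟨ *-comm _ _ ⟩
    Π[ R ] x                                     ∎

  det-Cplus-cycle : ∀ {m} (x : Fin (2 ℕ.+ m) → Carrier) →
    det R (Cplus R cycleEdges x) ≈ Π[ R ] x - fold (Π[ R ] x) -_ (2 ℕ.+ m)
  det-Cplus-cycle {m} x = begin
    det R (Cplus R cycleEdges x)
      ≈⟨ det-cong (λ e k → reflexive (Cplus-cycle x e k)) ⟩
    det R (cornerBidiagonal (x ∘ next) (x ∘ inject₁) (x (fromℕ (suc m))))
      ≈⟨ det-cornerBidiagonal (x ∘ next) (x ∘ inject₁) _ ⟩
    Π[ R ] (x ∘ next) - fold (x (fromℕ (suc m)) * Π[ R ] (x ∘ inject₁)) -_ (2 ℕ.+ m)
      ≈⟨ +-cong (Π-next x) (-‿cong (fold-neg-cong (2 ℕ.+ m) (trans (*-comm _ _) (sym (Π-init-last x))))) ⟩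
    Π[ R ] x - fold (Π[ R ] x) -_ (2 ℕ.+ m)
      ∎

  det-Cplus-cycle-odd : ∀ {m} (x : Fin (2 ℕ.+ m) → Carrier) → ¬ 2 ∣ (2 ℕ.+ m) →
    det R (Cplus R cycleEdges x) ≈ (1# + 1#) * Π[ R ] x
  det-Cplus-cycle-odd {m} x 2∤k = begin
    det R (Cplus R cycleEdges x)
      ≈⟨ det-Cplus-cycle x ⟩
    Π[ R ] x - fold (Π[ R ] x) -_ (2 ℕ.+ m)
      ≈⟨ +-congˡ (trans (-‿cong (fold-neg-odd (2 ℕ.+ m) 2∤k)) (-‿involutive _)) ⟩
    Π[ R ] x + Π[ R ] x
      ≈⟨ +-cong (*-identityˡ _) (*-identityˡ _) ⟨
    1# * Π[ R ] x + 1# * Π[ R ] x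
      ≈⟨ distribʳ _ _ _ ⟨
    (1# + 1#) * Π[ R ] x
      ∎

  det-Cplus-cycle-even : ∀ {m} (x : Fin (2 ℕ.+ m) → Carrier) → 2 ∣ (2 ℕ.+ m) →
    det R (Cplus R cycleEdges x) ≈ 0#
  det-Cplus-cycle-even {m} x 2∣k = begin
    det R (Cplus R cycleEdges x)
      ≈⟨ det-Cplus-cycle x ⟩
    Π[ R ] x - fold (Π[ R ] x) -_ (2 ℕ.+ m)
      ≈⟨ +-congˡ (-‿cong (fold-neg-even (2 ℕ.+ m) 2∣k)) ⟩
    Π[ R ] x - Π[ R ] x
      ≈⟨ -‿inverseʳ _ ⟩
    0#
      ∎

lemma6p4 : {c ℓ : Level} (k : ℕ) → 3 ≤ k →
    ((¬ (2 ∣ k)) →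
      ∃ λ (s : Bool) →
        ∀ (R : CommutativeRing c ℓ) (x : Fin k → CommutativeRing.Carrier R) →
          let open CommutativeRing R in
          det R (Cplus R cycleEdges x)
            ≈ (if s then ((1# + 1#) * Π[ R ] x) else (- ((1# + 1#) * Π[ R ] x))))
    × ((2 ∣ k) →
      ∀ (R : CommutativeRing c ℓ) (x : Fin k → CommutativeRing.Carrier R) →
        let open CommutativeRing R in
        det R (Cplus R cycleEdges x) ≈ 0#)
lemma6p4 (suc (suc (suc m))) _ =
  (λ 2∤k → true , λ R x → det-Cplus-cycle-odd R x 2∤k) , (λ 2∣k R x → det-Cplus-cycle-even R x 2∣k)
lemma6p4 (suc zero)       (s≤s ())
lemma6p4 (suc (suc zero)) (s≤s (s≤s ()))
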